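{- Let $\mathcal C'$ and $\mathcal A'$ be the full subcategories of $\mathcal C$ and $\mathcal A$ on which the dual adjunction $P\dashv S$ restricts to a dual equivalence (i.e. the objects $X$ with $\eta^{\mathcal C}_X$ an isomorphism, resp. the objects $A$ with $\eta^{\mathcal A}_A$ an isomorphism). Suppose that $\mathcal C$ has $(\mathrm{RegEpi},\mathrm{Mono})$-factorisations for morphisms with domain in $\mathcal C'$; that $\mathcal C'$ is closed under regular epimorphic images (if $X\in\mathcal C'$ and $e\colon X\to Y$ is a regular epimorphism in $\mathcal C$, then $Y\in\mathcal C'$); that $S$ is faithful; and that $L$ preserves epimorphisms. Then for every $T$-coalgebra $(X,\gamma)$ with $X\in\mathcal C'$, logical equivalence, i.e. the kernel pair $(B,\pi,\pi')$ of the theory map $\mathrm{th}_\gamma\colon X\to S\Phi$, is a $\rho$-bisimulation on $(X,\gamma)$.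
   Context: $P\colon\mathcal C\to\mathcal A$, $S\colon\mathcal A\to\mathcal C$ are contravariant functors forming a dual adjunction (natural bijection $\mathcal C(X,SA)\cong\mathcal A(A,PX)$) with units $\eta^{\mathcal C}\colon\mathrm{Id}_{\mathcal C}\to SP$, $\eta^{\mathcal A}\colon\mathrm{Id}_{\mathcal A}\to PS$. $T\colon\mathcal C\to\mathcal C$ is an endofunctor; a $T$-coalgebra is $(X,\gamma)$ with $\gamma\colon X\to TX$. $(L,\rho)$ is a logic: $L\colon\mathcal A\to\mathcal A$, $\rho\colon LP\to PT$ natural; the complex algebra is $\gamma^*=P\gamma\circ\rho_X\colon LPX\to PX$. $L$ has an initial algebra $(\Phi,\alpha)$; the semantics $[\![-]\!]_\gamma\colon\Phi\to PX$ is the unique $L$-algebra morphism to $(PX,\gamma^*)$ and the theory map is $\mathrm{th}_\gamma=S[\![-]\!]_\gamma\circ\eta^{\mathcal C}_X$. Standing assumptions: $\mathcal C$ has pullbacks, and $\mathcal A$ has pullbacks or $\mathcal C$ has pushouts. A span $X_1\xleftarrow{\pi_1}B\xrightarrow{\pi_2}X_2$ is jointly mono if $\pi_1h=\pi_1h'$ and $\pi_2h=\pi_2h'$ imply $h=h'$; its dual span $(\bar B,\bar\pi_1,\bar\pi_2)$ is the pullback in $\mathcal A$ of $PX_1\xrightarrow{P\pi_1}PB\xleftarrow{P\pi_2}PX_2$; it is a $\rho$-bisimulation between $(X_1,\gamma_1)$ and $(X_2,\gamma_2)$ if $P\pi_1\circ\gamma_1^*\circ L\bar\pi_1=P\pi_2\circ\gamma_2^*\circ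 L\bar\pi_2$. -}

module Defs where

open import Level using (Level; _⊔_) renaming (suc to lsuc)
open import Relation.Binary.PropositionalEquality using (_≡_)
open import Data.Product using (Σ; _×_; _,_; ∃)

record Category (o ℓ : Level) : Set (lsuc (o ⊔ ℓ)) where
  infixr 9 _∘_
  field
    Obj  : Set o
    Hom  : Obj → Obj → Set ℓ
    id   : ∀ {X} → Hom X X
    _∘_  : ∀ {X Y Z} → Hom Y Z → Hom X Y → Hom X Z
    identityˡ : ∀ {X Y} {f : Hom X Y} → id ∘ f ≡ f
    identityʳ : ∀ {X Y} {f : Hom X Y} → f ∘ id ≡ f
    assoc : ∀ {W X Y Z} {f : Hom W X} {g : Hom X Y} {h : Hom Y Z} →
            (h ∘ g) ∘ f ≡ h ∘ (g ∘ f)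

module _ {o ℓ : Level} (C : Category o ℓ) where
  open Category C

  Mono : ∀ {X Y} → Hom X Y → Set (o ⊔ ℓ)
  Mono {X} f = ∀ {W} (g h : Hom W X) → f ∘ g ≡ f ∘ h → g ≡ h

  Epi : ∀ {X Y} → Hom X Y → Set (o ⊔ ℓ)
  Epi {Y = Y} f = ∀ {Z} (g h : Hom Y Z) → g ∘ f ≡ h ∘ f → g ≡ h

  IsIso : ∀ {X Y} → Hom X Y → Set ℓ
  IsIso {X} {Y} f = Σ (Hom Y X) λ g → (g ∘ f ≡ id) × (f ∘ g ≡ id)

  record IsPullback {X Y Z Q : Obj} (f : Hom X Z) (g : Hom Y Z)
                    (q₁ : Hom Q X) (q₂ : Hom Q Y) : Set (o ⊔ ℓ) where
    field
      commute   : f ∘ q₁ ≡ g ∘ q₂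
      universal : ∀ {W} (h₁ : Hom W X) (h₂ : Hom W Y) → f ∘ h₁ ≡ g ∘ h₂ →
                  Σ (Hom W Q) λ u → (q₁ ∘ u ≡ h₁) × (q₂ ∘ u ≡ h₂) ×
                    (∀ (v : Hom W Q) → q₁ ∘ v ≡ h₁ → q₂ ∘ v ≡ h₂ → v ≡ u)

  record Pullback {X Y Z : Obj} (f : Hom X Z) (g : Hom Y Z) : Set (o ⊔ ℓ) where
    field
      obj  : Obj
      p₁   : Hom obj X
      p₂   : Hom obj Y
      isPullback : IsPullback f g p₁ p₂

  HasPullbacks : Set (o ⊔ ℓ)
  HasPullbacks = ∀ {X Y Z} (f : Hom X Z) (g : Hom Y Z) → Pullback f g

  record Pushout {X Y Z : Obj} (f : Hom Z X) (g : Hom Z Y) : Set (o ⊔ ℓ) where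
    field
      obj  : Obj
      i₁   : Hom X obj
      i₂   : Hom Y obj
      commute   : i₁ ∘ f ≡ i₂ ∘ g
      universal : ∀ {W} (h₁ : Hom X W) (h₂ : Hom Y W) → h₁ ∘ f ≡ h₂ ∘ g →
                  Σ (Hom obj W) λ u → (u ∘ i₁ ≡ h₁) × (u ∘ i₂ ≡ h₂) ×
                    (∀ (v : Hom obj W) → v ∘ i₁ ≡ h₁ → v ∘ i₂ ≡ h₂ → v ≡ u)

  HasPushouts : Set (o ⊔ ℓ)
  HasPushouts = ∀ {X Y Z} (f : Hom Z X) (g : Hom Z Y) → Pushout f g

  record IsCoequalizer {Z X Y : Obj} (g h : Hom Z X) (e : Hom X Y) : Set (o ⊔ ℓ) where
    field
      equality  : e ∘ g ≡ e ∘ h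
      universal : ∀ {W} (k : Hom X W) → k ∘ g ≡ k ∘ h →
                  Σ (Hom Y W) λ u → (u ∘ e ≡ k) × (∀ (v : Hom Y W) → v ∘ e ≡ k → v ≡ u)

  RegularEpi : ∀ {X Y} → Hom X Y → Set (o ⊔ ℓ)
  RegularEpi {X} e = Σ Obj λ Z → Σ (Hom Z X) λ g → Σ (Hom Z X) λ h → IsCoequalizer g h e

record Functor {o₁ ℓ₁ o₂ ℓ₂} (C : Category o₁ ℓ₁) (D : Category o₂ ℓ₂)
       : Set (o₁ ⊔ ℓ₁ ⊔ o₂ ⊔ ℓ₂) where
  private module C = Category C
  private module D = Category D
  field
    F₀ : C.Obj → D.Obj
    F₁ : ∀ {X Y} → C.Hom X Y → D.Hom (F₀ X) (F₀ Y)
    identity : ∀ {X} → F₁ (C.id {X}) ≡ D.id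
    homomorphism : ∀ {X Y Z} {f : C.Hom X Y} {g : C.Hom Y Z} →
                   F₁ (g C.∘ f) ≡ F₁ g D.∘ F₁ f

record ContraFunctor {o₁ ℓ₁ o₂ ℓ₂} (C : Category o₁ ℓ₁) (D : Category o₂ ℓ₂)
       : Set (o₁ ⊔ ℓ₁ ⊔ o₂ ⊔ ℓ₂) where
  private module C = Category C
  private module D = Category D
  field
    F₀ : C.Obj → D.Obj
    F₁ : ∀ {X Y} → C.Hom X Y → D.Hom (F₀ Y) (F₀ X)
    identity : ∀ {X} → F₁ (C.id {X}) ≡ D.id
    homomorphism : ∀ {X Y Z} {f : C.Hom X Y} {g : C.Hom Y Z} →
                   F₁ (g C.∘ f) ≡ F₁ f D.∘ F₁ g

ContraFaithful : ∀ {o₁ ℓ₁ o₂ ℓ₂} {C : Category o₁ ℓ₁} {D : Category o₂ ℓ₂} →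
                 ContraFunctor C D → Set (o₁ ⊔ ℓ₁ ⊔ ℓ₂)
ContraFaithful {C = C} F = ∀ {X Y} (f g : Category.Hom C X Y) →
                           ContraFunctor.F₁ F f ≡ ContraFunctor.F₁ F g → f ≡ g

PreservesEpis : ∀ {o ℓ} {A : Category o ℓ} → Functor A A → Set (o ⊔ ℓ)
PreservesEpis {A = A} L = ∀ {X Y} (f : Category.Hom A X Y) →
                          Epi A f → Epi A (Functor.F₁ L f)

-- Dual adjunction P ⊣ S (P : C → A, S : A → C contravariant), presented by
-- its two units and the triangle identities; this is equivalent to a
-- natural bijection C(X, SA) ≅ A(A, PX) via f ↦ Pf ∘ ηᴬ_A, g ↦ Sg ∘ ηᶜ_X.

record DualAdjunction {o₁ ℓ₁ o₂ ℓ₂} (C : Category o₁ ℓ₁) (A : Category o₂ ℓ₂)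
       : Set (o₁ ⊔ ℓ₁ ⊔ o₂ ⊔ ℓ₂) where
  private module C = Category C
  private module A = Category A
  field
    P : ContraFunctor C A
    S : ContraFunctor A C
  module P = ContraFunctor P
  module S = ContraFunctor S
  field
    ηᶜ : ∀ X → C.Hom X (S.F₀ (P.F₀ X))
    ηᴬ : ∀ B → A.Hom B (P.F₀ (S.F₀ B))
    ηᶜ-natural : ∀ {X Y} (f : C.Hom X Y) →
                 S.F₁ (P.F₁ f) C.∘ ηᶜ X ≡ ηᶜ Y C.∘ f
    ηᴬ-natural : ∀ {B B'} (g : A.Hom B B') →
                 P.F₁ (S.F₁ g) A.∘ ηᴬ B ≡ ηᴬ B' A.∘ g
    triangleᶜ : ∀ B → S.F₁ (ηᴬ B) C.∘ ηᶜ (S.F₀ B) ≡ C.id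
    triangleᴬ : ∀ X → P.F₁ (ηᶜ X) A.∘ ηᴬ (P.F₀ X) ≡ A.id

record Setting (o₁ ℓ₁ o₂ ℓ₂ : Level) : Set (lsuc (o₁ ⊔ ℓ₁ ⊔ o₂ ⊔ ℓ₂)) where
  field
    C   : Category o₁ ℓ₁
    A   : Category o₂ ℓ₂
    adj : DualAdjunction C A
  module C = Category C
  module A = Category A
  open DualAdjunction adj public
  field
    T : Functor C C
    L : Functor A A
  module T = Functor T
  module L = Functor L
  field
    ρ : ∀ X → A.Hom (L.F₀ (P.F₀ X)) (P.F₀ (T.F₀ X))
    ρ-natural : ∀ {X Y} (f : C.Hom X Y) →
                ρ X A.∘ L.F₁ (P.F₁ f) ≡ P.F₁ (T.F₁ f) A.∘ ρ Y
    Φ : A.Obj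
    α : A.Hom (L.F₀ Φ) Φ
    initial : ∀ (B : A.Obj) (β : A.Hom (L.F₀ B) B) →
              Σ (A.Hom Φ B) λ h → (h A.∘ α ≡ β A.∘ L.F₁ h) ×
                (∀ (k : A.Hom Φ B) → k A.∘ α ≡ β A.∘ L.F₁ k → k ≡ h)

  complexAlgebra : ∀ {X} (γ : C.Hom X (T.F₀ X)) → A.Hom (L.F₀ (P.F₀ X)) (P.F₀ X)
  complexAlgebra {X} γ = P.F₁ γ A.∘ ρ X

  semantics : ∀ {X} (γ : C.Hom X (T.F₀ X)) → A.Hom Φ (P.F₀ X)
  semantics {X} γ = Data.Product.proj₁ (initial (P.F₀ X) (complexAlgebra γ))
    where import Data.Product

  th : ∀ {X} (γ : C.Hom X (T.F₀ X)) → C.Hom X (S.F₀ Φ)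
  th {X} γ = S.F₁ (semantics γ) C.∘ ηᶜ X

  InC' : C.Obj → Set ℓ₁
  InC' X = IsIso C (ηᶜ X)

  InA' : A.Obj → Set ℓ₂
  InA' B = IsIso A (ηᴬ B)

  RegEpiMonoFactorisationsOnC' : Set (o₁ ⊔ ℓ₁)
  RegEpiMonoFactorisationsOnC' =
    ∀ {X Y} → InC' X → (f : C.Hom X Y) →
    Σ C.Obj λ Z → Σ (C.Hom X Z) λ e → Σ (C.Hom Z Y) λ m →
      RegularEpi C e × Mono C m × (m C.∘ e ≡ f)

  C'ClosedUnderRegEpiImages : Set (o₁ ⊔ ℓ₁)
  C'ClosedUnderRegEpiImages =
    ∀ {X Y} (e : C.Hom X Y) → InC' X → RegularEpi C e → InC' Y

  -- A span X₁ <-π₁- B -π₂-> X₂ is a ρ-bisimulation between (X₁,γ₁), (X₂,γ₂)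
  -- if for its dual span (B̄, π̄₁, π̄₂), the pullback in A of
  -- PX₁ -Pπ₁-> PB <-Pπ₂- PX₂, we have
  --   Pπ₁ ∘ γ₁* ∘ Lπ̄₁ = Pπ₂ ∘ γ₂* ∘ Lπ̄₂.
  -- (The condition does not depend on the choice of pullback, so we
  -- require it for every pullback.)
  IsρBisimulation : ∀ {X₁ X₂ B} (γ₁ : C.Hom X₁ (T.F₀ X₁)) (γ₂ : C.Hom X₂ (T.F₀ X₂))
                    (π₁ : C.Hom B X₁) (π₂ : C.Hom B X₂) → Set (o₂ ⊔ ℓ₂)
  IsρBisimulation γ₁ γ₂ π₁ π₂ =
    (D : Pullback A (P.F₁ π₁) (P.F₁ π₂)) →
    P.F₁ π₁ A.∘ (complexAlgebra γ₁ A.∘ L.F₁ (Pullback.p₁ D)) ≡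
    P.F₁ π₂ A.∘ (complexAlgebra γ₂ A.∘ L.F₁ (Pullback.p₂ D))

-- Factor th_γ = m ∘ e with e a regular epi and m a mono. The codomain Z of e lies in C',
-- so the transpose k : Φ → PZ of m has S k = m ∘ ηᶜ_Z⁻¹ mono, hence k is epi (S is
-- faithful), and so is L k. Since ⟦-⟧_γ = Pe ∘ k is an algebra morphism, testing
-- against the epi L k shows that Pπ ∘ γ* ∘ L(Pe) does not depend on the leg π of the
-- kernel pair, which e coequalises. Finally both legs of the dual span coincide (the
-- kernel pair has a diagonal) and factor through Pe, because e weakly coequalises the
-- kernel pair and P turns this into a factorisation property of Pe.
module Submission where

open import Level using (_⊔_)
open import Defs
open import Data.Sum using (_⊎_)
open import Data.Product using (Σ; _×_; _,_; proj₁; proj₂)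
open import Relation.Binary.PropositionalEquality
open ≡-Reasoning

module _ {o ℓ} (C : Category o ℓ) where
  open Category C

  IsWeakCoequalizer : ∀ {K X Y} (p₁ p₂ : Hom K X) (e : Hom X Y) → Set (o ⊔ ℓ)
  IsWeakCoequalizer {X = X} {Y} p₁ p₂ e =
    (e ∘ p₁ ≡ e ∘ p₂) ×
    (∀ {W} (k : Hom X W) → k ∘ p₁ ≡ k ∘ p₂ → Σ (Hom Y W) λ w → w ∘ e ≡ k)

  ∘-equalises : ∀ {W X Y Z} {a b : Hom W X} {f : Hom X Y} (g : Hom Y Z) →
                f ∘ a ≡ f ∘ b → (g ∘ f) ∘ a ≡ (g ∘ f) ∘ b
  ∘-equalises {a = a} {b} {f} g eq = begin
    (g ∘ f) ∘ a ≡⟨ assoc ⟩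
    g ∘ (f ∘ a) ≡⟨ cong (g ∘_) eq ⟩
    g ∘ (f ∘ b) ≡⟨ assoc ⟨
    (g ∘ f) ∘ b ∎

  equalises-∘ : ∀ {V W X Y} {a b : Hom W X} {f : Hom X Y} (c : Hom V W) →
                f ∘ a ≡ f ∘ b → f ∘ (a ∘ c) ≡ f ∘ (b ∘ c)
  equalises-∘ {a = a} {b} {f} c eq = begin
    f ∘ (a ∘ c) ≡⟨ assoc ⟨
    (f ∘ a) ∘ c ≡⟨ cong (_∘ c) eq ⟩
    (f ∘ b) ∘ c ≡⟨ assoc ⟩
    f ∘ (b ∘ c) ∎

  section⇒Mono : ∀ {X Y} {s : Hom X Y} {r : Hom Y X} → r ∘ s ≡ id → Mono C s
  section⇒Mono {s = s} {r} rs≡id a b eq = begin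
    a             ≡⟨ identityˡ ⟨
    id ∘ a        ≡⟨ cong (_∘ a) rs≡id ⟨
    (r ∘ s) ∘ a   ≡⟨ ∘-equalises r eq ⟩
    (r ∘ s) ∘ b   ≡⟨ cong (_∘ b) rs≡id ⟩
    id ∘ b        ≡⟨ identityˡ ⟩
    b             ∎

  Mono-∘ : ∀ {X Y Z} {f : Hom Y Z} {g : Hom X Y} → Mono C f → Mono C g → Mono C (f ∘ g)
  Mono-∘ {g = g} f-mono g-mono a b eq =
    g-mono a b (f-mono (g ∘ a) (g ∘ b) (trans (sym assoc) (trans eq assoc)))

  kernelPair-diagonal : ∀ {K X Y} {f : Hom X Y} {p₁ p₂ : Hom K X} →
                        IsPullback C f f p₁ p₂ →
                        Σ (Hom X K) λ δ → (p₁ ∘ δ ≡ id) × (p₂ ∘ δ ≡ id)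
  kernelPair-diagonal pb =
    let (δ , p₁δ≡id , p₂δ≡id , _) = IsPullback.universal pb id id refl
    in δ , p₁δ≡id , p₂δ≡id

  regularEpi-weaklyCoequalises-kernelPair :
    ∀ {K X Y Z} {f : Hom X Z} {e : Hom X Y} {m : Hom Y Z} {p₁ p₂ : Hom K X} →
    RegularEpi C e → Mono C m → m ∘ e ≡ f → IsPullback C f f p₁ p₂ →
    IsWeakCoequalizer p₁ p₂ e
  regularEpi-weaklyCoequalises-kernelPair {f = f} {e} {m} {p₁} {p₂}
                                          (_ , g , h , coeq) m-mono me≡f pb =
    e-equalises , factor
    where
    module coeq = IsCoequalizer coeq
    module pb = IsPullback pb

    e-equalises : e ∘ p₁ ≡ e ∘ p₂
    e-equalises = m-mono _ _ (begin
      m ∘ (e ∘ p₁) ≡⟨ assoc ⟨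
      (m ∘ e) ∘ p₁ ≡⟨ cong (_∘ p₁) me≡f ⟩
      f ∘ p₁       ≡⟨ pb.commute ⟩
      f ∘ p₂       ≡⟨ cong (_∘ p₂) me≡f ⟨
      (m ∘ e) ∘ p₂ ≡⟨ assoc ⟩
      m ∘ (e ∘ p₂) ∎)

    f-equalises : f ∘ g ≡ f ∘ h
    f-equalises = subst (λ f → f ∘ g ≡ f ∘ h) me≡f (∘-equalises m coeq.equality)

    factor : ∀ {W} (k : Hom _ W) → k ∘ p₁ ≡ k ∘ p₂ → Σ (Hom _ W) λ w → w ∘ e ≡ k
    factor k k-equalises =
      let (q , p₁q≡g , p₂q≡h , _) = pb.universal g h f-equalises
          k-equalises-gh = subst₂ (λ a b → k ∘ a ≡ k ∘ b) p₁q≡g p₂q≡h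
                                  (equalises-∘ q k-equalises)
          (w , we≡k , _) = coeq.universal k k-equalises-gh
      in w , we≡k

module _ {o₁ ℓ₁ o₂ ℓ₂} {C : Category o₁ ℓ₁} {D : Category o₂ ℓ₂}
         (F : ContraFunctor C D) where
  private
    module C = Category C
    module D = Category D
  open ContraFunctor F

  F₁-square : ∀ {X Y Y' Z B} {f : C.Hom X Y} {g : C.Hom Y Z}
              {f' : C.Hom X Y'} {g' : C.Hom Y' Z} (x : D.Hom B (F₀ Z)) →
              g C.∘ f ≡ g' C.∘ f' → F₁ f D.∘ (F₁ g D.∘ x) ≡ F₁ f' D.∘ (F₁ g' D.∘ x)
  F₁-square {f = f} {g} {f'} {g'} x eq = begin
    F₁ f D.∘ (F₁ g D.∘ x)   ≡⟨ D.assoc ⟨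
    (F₁ f D.∘ F₁ g) D.∘ x   ≡⟨ cong (D._∘ x) homomorphism ⟨
    F₁ (g C.∘ f) D.∘ x      ≡⟨ cong (λ t → F₁ t D.∘ x) eq ⟩
    F₁ (g' C.∘ f') D.∘ x    ≡⟨ cong (D._∘ x) homomorphism ⟩
    (F₁ f' D.∘ F₁ g') D.∘ x ≡⟨ D.assoc ⟩
    F₁ f' D.∘ (F₁ g' D.∘ x) ∎

  commonSection-collapses : ∀ {X K B} {p₁ p₂ : C.Hom K X} {δ : C.Hom X K}
                            {d₁ d₂ : D.Hom B (F₀ X)} →
                            p₁ C.∘ δ ≡ C.id → p₂ C.∘ δ ≡ C.id →
                            F₁ p₁ D.∘ d₁ ≡ F₁ p₂ D.∘ d₂ → d₁ ≡ d₂
  commonSection-collapses {p₁ = p₁} {p₂} {δ} {d₁} {d₂} p₁δ≡id p₂δ≡id commute = begin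
    d₁                      ≡⟨ D.identityˡ ⟨
    D.id D.∘ d₁             ≡⟨ cong (D._∘ d₁) identity ⟨
    F₁ C.id D.∘ d₁          ≡⟨ cong (λ t → F₁ t D.∘ d₁) p₁δ≡id ⟨
    F₁ (p₁ C.∘ δ) D.∘ d₁    ≡⟨ cong (D._∘ d₁) homomorphism ⟩
    (F₁ δ D.∘ F₁ p₁) D.∘ d₁ ≡⟨ D.assoc ⟩
    F₁ δ D.∘ (F₁ p₁ D.∘ d₁) ≡⟨ cong (F₁ δ D.∘_) commute ⟩
    F₁ δ D.∘ (F₁ p₂ D.∘ d₂) ≡⟨ D.assoc ⟨
    (F₁ δ D.∘ F₁ p₂) D.∘ d₂ ≡⟨ cong (D._∘ d₂) homomorphism ⟨
    F₁ (p₂ C.∘ δ) D.∘ d₂    ≡⟨ cong (λ t → F₁ t D.∘ d₂) p₂δ≡id ⟩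
    F₁ C.id D.∘ d₂          ≡⟨ cong (D._∘ d₂) identity ⟩
    D.id D.∘ d₂             ≡⟨ D.identityˡ ⟩
    d₂                      ∎

  faithful-reflects-Epi : ContraFaithful F → ∀ {X Y} {f : C.Hom X Y} →
                          Mono D (F₁ f) → Epi C f
  faithful-reflects-Epi faithful {f = f} Ff-mono g h gf≡hf = faithful g h (Ff-mono _ _ (begin
    F₁ f D.∘ F₁ g ≡⟨ homomorphism ⟨
    F₁ (g C.∘ f)  ≡⟨ cong F₁ gf≡hf ⟩
    F₁ (h C.∘ f)  ≡⟨ homomorphism ⟩
    F₁ f D.∘ F₁ h ∎))

module DualAdjunctionProperties {o₁ ℓ₁ o₂ ℓ₂} {C : Category o₁ ℓ₁} {A : Category o₂ ℓ₂}
                                (adj : DualAdjunction C A) where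
  open DualAdjunction adj
  private
    module C = Category C
    module A = Category A

  transposeᶜ : ∀ {X B} → A.Hom B (P.F₀ X) → C.Hom X (S.F₀ B)
  transposeᶜ {X} d = S.F₁ d C.∘ ηᶜ X

  transposeᴬ : ∀ {X B} → C.Hom X (S.F₀ B) → A.Hom B (P.F₀ X)
  transposeᴬ {B = B} f = P.F₁ f A.∘ ηᴬ B

  transposeᴬ-transposeᶜ : ∀ {X B} (d : A.Hom B (P.F₀ X)) → transposeᴬ (transposeᶜ d) ≡ d
  transposeᴬ-transposeᶜ {X} {B} d = begin
    P.F₁ (S.F₁ d C.∘ ηᶜ X) A.∘ ηᴬ B            ≡⟨ cong (A._∘ ηᴬ B) P.homomorphism ⟩
    (P.F₁ (ηᶜ X) A.∘ P.F₁ (S.F₁ d)) A.∘ ηᴬ B   ≡⟨ A.assoc ⟩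
    P.F₁ (ηᶜ X) A.∘ (P.F₁ (S.F₁ d) A.∘ ηᴬ B)   ≡⟨ cong (P.F₁ (ηᶜ X) A.∘_) (ηᴬ-natural d) ⟩
    P.F₁ (ηᶜ X) A.∘ (ηᴬ (P.F₀ X) A.∘ d)        ≡⟨ A.assoc ⟨
    (P.F₁ (ηᶜ X) A.∘ ηᴬ (P.F₀ X)) A.∘ d        ≡⟨ cong (A._∘ d) (triangleᴬ X) ⟩
    A.id A.∘ d                                 ≡⟨ A.identityˡ ⟩
    d                                          ∎

  transposeᶜ-transposeᴬ : ∀ {X B} (f : C.Hom X (S.F₀ B)) → transposeᶜ (transposeᴬ f) ≡ f
  transposeᶜ-transposeᴬ {X} {B} f = begin
    S.F₁ (P.F₁ f A.∘ ηᴬ B) C.∘ ηᶜ X            ≡⟨ cong (C._∘ ηᶜ X) S.homomorphism ⟩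
    (S.F₁ (ηᴬ B) C.∘ S.F₁ (P.F₁ f)) C.∘ ηᶜ X   ≡⟨ C.assoc ⟩
    S.F₁ (ηᴬ B) C.∘ (S.F₁ (P.F₁ f) C.∘ ηᶜ X)   ≡⟨ cong (S.F₁ (ηᴬ B) C.∘_) (ηᶜ-natural f) ⟩
    S.F₁ (ηᴬ B) C.∘ (ηᶜ (S.F₀ B) C.∘ f)        ≡⟨ C.assoc ⟨
    (S.F₁ (ηᴬ B) C.∘ ηᶜ (S.F₀ B)) C.∘ f        ≡⟨ cong (C._∘ f) (triangleᶜ B) ⟩
    C.id C.∘ f                                 ≡⟨ C.identityˡ ⟩
    f                                          ∎

  transposeᴬ-natural : ∀ {X Y B} (f : C.Hom Y (S.F₀ B)) (g : C.Hom X Y) →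
                       P.F₁ g A.∘ transposeᴬ f ≡ transposeᴬ (f C.∘ g)
  transposeᴬ-natural {B = B} f g = begin
    P.F₁ g A.∘ (P.F₁ f A.∘ ηᴬ B)  ≡⟨ A.assoc ⟨
    (P.F₁ g A.∘ P.F₁ f) A.∘ ηᴬ B  ≡⟨ cong (A._∘ ηᴬ B) P.homomorphism ⟨
    P.F₁ (f C.∘ g) A.∘ ηᴬ B       ∎

  transposeᶜ-natural : ∀ {X Y B} (d : A.Hom B (P.F₀ Y)) (g : C.Hom X Y) →
                       transposeᶜ d C.∘ g ≡ transposeᶜ (P.F₁ g A.∘ d)
  transposeᶜ-natural {X} {Y} d g = begin
    (S.F₁ d C.∘ ηᶜ Y) C.∘ g                 ≡⟨ C.assoc ⟩
    S.F₁ d C.∘ (ηᶜ Y C.∘ g)                 ≡⟨ cong (S.F₁ d C.∘_) (ηᶜ-natural g) ⟨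
    S.F₁ d C.∘ (S.F₁ (P.F₁ g) C.∘ ηᶜ X)     ≡⟨ C.assoc ⟨
    (S.F₁ d C.∘ S.F₁ (P.F₁ g)) C.∘ ηᶜ X     ≡⟨ cong (C._∘ ηᶜ X) S.homomorphism ⟨
    S.F₁ (P.F₁ g A.∘ d) C.∘ ηᶜ X            ∎

  P-weakCoequalizer-factorises : ∀ {K X Y B} {p₁ p₂ : C.Hom K X} {e : C.Hom X Y} →
    IsWeakCoequalizer C p₁ p₂ e → (d : A.Hom B (P.F₀ X)) →
    P.F₁ p₁ A.∘ d ≡ P.F₁ p₂ A.∘ d → Σ (A.Hom B (P.F₀ Y)) λ v → P.F₁ e A.∘ v ≡ d
  P-weakCoequalizer-factorises {p₁ = p₁} {p₂} {e} (_ , factor) d Pp₁d≡Pp₂d =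
    transposeᴬ w , (begin
      P.F₁ e A.∘ transposeᴬ w        ≡⟨ transposeᴬ-natural w e ⟩
      transposeᴬ (w C.∘ e)           ≡⟨ cong transposeᴬ we≡d♯ ⟩
      transposeᴬ (transposeᶜ d)      ≡⟨ transposeᴬ-transposeᶜ d ⟩
      d                              ∎)
    where
    d♯-equalises : transposeᶜ d C.∘ p₁ ≡ transposeᶜ d C.∘ p₂
    d♯-equalises = begin
      transposeᶜ d C.∘ p₁            ≡⟨ transposeᶜ-natural d p₁ ⟩
      transposeᶜ (P.F₁ p₁ A.∘ d)     ≡⟨ cong transposeᶜ Pp₁d≡Pp₂d ⟩
      transposeᶜ (P.F₁ p₂ A.∘ d)     ≡⟨ transposeᶜ-natural d p₂ ⟨
      transposeᶜ d C.∘ p₂            ∎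
    w = proj₁ (factor (transposeᶜ d) d♯-equalises)
    we≡d♯ = proj₂ (factor (transposeᶜ d) d♯-equalises)

  transposeᴬ-Epi : ContraFaithful S → ∀ {Z B} {m : C.Hom Z (S.F₀ B)} →
                   IsIso C (ηᶜ Z) → Mono C m → Epi A (transposeᴬ m)
  transposeᴬ-Epi faithful {Z} {m = m} (η⁻¹ , _ , ηη⁻¹≡id) m-mono =
    faithful-reflects-Epi S faithful (subst (Mono C) (sym Sm♭≡mη⁻¹)
      (Mono-∘ C m-mono (section⇒Mono C ηη⁻¹≡id)))
    where
    Sm♭≡mη⁻¹ : S.F₁ (transposeᴬ m) ≡ m C.∘ η⁻¹
    Sm♭≡mη⁻¹ = begin
      S.F₁ (transposeᴬ m)                     ≡⟨ C.identityʳ ⟨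
      S.F₁ (transposeᴬ m) C.∘ C.id            ≡⟨ cong (S.F₁ (transposeᴬ m) C.∘_) ηη⁻¹≡id ⟨
      S.F₁ (transposeᴬ m) C.∘ (ηᶜ Z C.∘ η⁻¹)  ≡⟨ C.assoc ⟨
      transposeᶜ (transposeᴬ m) C.∘ η⁻¹       ≡⟨ cong (C._∘ η⁻¹) (transposeᶜ-transposeᴬ m) ⟩
      m C.∘ η⁻¹                               ∎

module _ {o₁ ℓ₁ o₂ ℓ₂} (𝕊 : Setting o₁ ℓ₁ o₂ ℓ₂) where
  open Setting 𝕊
  open DualAdjunctionProperties adj

  semantics-isHomomorphism : ∀ {X} (γ : C.Hom X (T.F₀ X)) →
                             semantics γ A.∘ α ≡ complexAlgebra γ A.∘ L.F₁ (semantics γ)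
  semantics-isHomomorphism {X} γ = proj₁ (proj₂ (initial (P.F₀ X) (complexAlgebra γ)))

  semantics-factorises : ∀ {X Z} (γ : C.Hom X (T.F₀ X)) {e : C.Hom X Z} {m : C.Hom Z (S.F₀ Φ)} →
                         m C.∘ e ≡ th γ → P.F₁ e A.∘ transposeᴬ m ≡ semantics γ
  semantics-factorises γ {e} {m} me≡th = begin
    P.F₁ e A.∘ transposeᴬ m                ≡⟨ transposeᴬ-natural m e ⟩
    transposeᴬ (m C.∘ e)                   ≡⟨ cong transposeᴬ me≡th ⟩
    transposeᴬ (transposeᶜ (semantics γ))  ≡⟨ transposeᴬ-transposeᶜ (semantics γ) ⟩
    semantics γ                            ∎

  complexAlgebra-equalised :
    ∀ {X Y K B} (γ : C.Hom X (T.F₀ X)) {e : C.Hom X Y} {k : A.Hom Φ (P.F₀ Y)}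
    {p₁ p₂ : C.Hom K X} → Epi A (L.F₁ k) → P.F₁ e A.∘ k ≡ semantics γ →
    e C.∘ p₁ ≡ e C.∘ p₂ → (v : A.Hom B (P.F₀ Y)) →
    P.F₁ p₁ A.∘ (complexAlgebra γ A.∘ L.F₁ (P.F₁ e A.∘ v)) ≡
    P.F₁ p₂ A.∘ (complexAlgebra γ A.∘ L.F₁ (P.F₁ e A.∘ v))
  complexAlgebra-equalised γ {e} {k} {p₁} {p₂} Lk-epi Pek≡⟦⟧ ep₁≡ep₂ v = begin
    P.F₁ p₁ A.∘ (γ* A.∘ L.F₁ (P.F₁ e A.∘ v))        ≡⟨ reassociate p₁ ⟩
    ((P.F₁ p₁ A.∘ γ*) A.∘ L.F₁ (P.F₁ e)) A.∘ L.F₁ v ≡⟨ cong (A._∘ L.F₁ v) LPe-equalised ⟩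
    ((P.F₁ p₂ A.∘ γ*) A.∘ L.F₁ (P.F₁ e)) A.∘ L.F₁ v ≡⟨ reassociate p₂ ⟨
    P.F₁ p₂ A.∘ (γ* A.∘ L.F₁ (P.F₁ e A.∘ v))        ∎
    where
    γ* = complexAlgebra γ

    reassociate : ∀ p → P.F₁ p A.∘ (γ* A.∘ L.F₁ (P.F₁ e A.∘ v)) ≡
                        ((P.F₁ p A.∘ γ*) A.∘ L.F₁ (P.F₁ e)) A.∘ L.F₁ v
    reassociate p = begin
      P.F₁ p A.∘ (γ* A.∘ L.F₁ (P.F₁ e A.∘ v))            ≡⟨ A.assoc ⟨
      (P.F₁ p A.∘ γ*) A.∘ L.F₁ (P.F₁ e A.∘ v)            ≡⟨ cong ((P.F₁ p A.∘ γ*) A.∘_) L.homomorphism ⟩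
      (P.F₁ p A.∘ γ*) A.∘ (L.F₁ (P.F₁ e) A.∘ L.F₁ v)     ≡⟨ A.assoc ⟨
      ((P.F₁ p A.∘ γ*) A.∘ L.F₁ (P.F₁ e)) A.∘ L.F₁ v     ∎

    unfold-semantics : ∀ p → ((P.F₁ p A.∘ γ*) A.∘ L.F₁ (P.F₁ e)) A.∘ L.F₁ k ≡
                             P.F₁ p A.∘ (P.F₁ e A.∘ (k A.∘ α))
    unfold-semantics p = begin
      ((P.F₁ p A.∘ γ*) A.∘ L.F₁ (P.F₁ e)) A.∘ L.F₁ k     ≡⟨ A.assoc ⟩
      (P.F₁ p A.∘ γ*) A.∘ (L.F₁ (P.F₁ e) A.∘ L.F₁ k)     ≡⟨ cong ((P.F₁ p A.∘ γ*) A.∘_) L.homomorphism ⟨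
      (P.F₁ p A.∘ γ*) A.∘ L.F₁ (P.F₁ e A.∘ k)            ≡⟨ cong (λ s → (P.F₁ p A.∘ γ*) A.∘ L.F₁ s) Pek≡⟦⟧ ⟩
      (P.F₁ p A.∘ γ*) A.∘ L.F₁ (semantics γ)             ≡⟨ A.assoc ⟩
      P.F₁ p A.∘ (γ* A.∘ L.F₁ (semantics γ))             ≡⟨ cong (P.F₁ p A.∘_) (semantics-isHomomorphism γ) ⟨
      P.F₁ p A.∘ (semantics γ A.∘ α)                     ≡⟨ cong (λ s → P.F₁ p A.∘ (s A.∘ α)) Pek≡⟦⟧ ⟨
      P.F₁ p A.∘ ((P.F₁ e A.∘ k) A.∘ α)                  ≡⟨ cong (P.F₁ p A.∘_) A.assoc ⟩
      P.F₁ p A.∘ (P.F₁ e A.∘ (k A.∘ α))                  ∎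

    LPe-equalised : (P.F₁ p₁ A.∘ γ*) A.∘ L.F₁ (P.F₁ e) ≡ (P.F₁ p₂ A.∘ γ*) A.∘ L.F₁ (P.F₁ e)
    LPe-equalised = Lk-epi _ _ (begin
      ((P.F₁ p₁ A.∘ γ*) A.∘ L.F₁ (P.F₁ e)) A.∘ L.F₁ k ≡⟨ unfold-semantics p₁ ⟩
      P.F₁ p₁ A.∘ (P.F₁ e A.∘ (k A.∘ α))              ≡⟨ F₁-square P (k A.∘ α) ep₁≡ep₂ ⟩
      P.F₁ p₂ A.∘ (P.F₁ e A.∘ (k A.∘ α))              ≡⟨ unfold-semantics p₂ ⟨
      ((P.F₁ p₂ A.∘ γ*) A.∘ L.F₁ (P.F₁ e)) A.∘ L.F₁ k ∎)

  kernelPair-isρBisimulation :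
    ContraFaithful S → PreservesEpis L →
    ∀ {X Z} (γ : C.Hom X (T.F₀ X)) {e : C.Hom X Z} {m : C.Hom Z (S.F₀ Φ)} →
    InC' Z → RegularEpi C e → Mono C m → m C.∘ e ≡ th γ →
    (K : Pullback C (th γ) (th γ)) → IsρBisimulation γ γ (Pullback.p₁ K) (Pullback.p₂ K)
  kernelPair-isρBisimulation faithful preservesEpis γ {e} {m} Z∈C' e-regular m-mono me≡th K D =
    begin
    P.F₁ K.p₁ A.∘ (γ* A.∘ L.F₁ D.p₁)              ≡⟨ cong (λ d → P.F₁ K.p₁ A.∘ (γ* A.∘ L.F₁ d)) Pev≡d₁ ⟨
    P.F₁ K.p₁ A.∘ (γ* A.∘ L.F₁ (P.F₁ e A.∘ v))    ≡⟨ complexAlgebra-equalised γ Lk-epi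
                                                         (semantics-factorises γ me≡th) e-equalises v ⟩
    P.F₁ K.p₂ A.∘ (γ* A.∘ L.F₁ (P.F₁ e A.∘ v))    ≡⟨ cong (λ d → P.F₁ K.p₂ A.∘ (γ* A.∘ L.F₁ d))
                                                         (trans Pev≡d₁ d₁≡d₂) ⟩
    P.F₁ K.p₂ A.∘ (γ* A.∘ L.F₁ D.p₂)              ∎
    where
    module K = Pullback K
    module D = Pullback D
    module D-pb = IsPullback D.isPullback
    γ* = complexAlgebra γ

    e-weaklyCoequalises : IsWeakCoequalizer C K.p₁ K.p₂ e
    e-weaklyCoequalises =
      regularEpi-weaklyCoequalises-kernelPair C e-regular m-mono me≡th K.isPullback

    e-equalises : e C.∘ K.p₁ ≡ e C.∘ K.p₂
    e-equalises = proj₁ e-weaklyCoequalises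

    Lk-epi : Epi A (L.F₁ (transposeᴬ m))
    Lk-epi = preservesEpis _ (transposeᴬ-Epi faithful Z∈C' m-mono)

    d₁≡d₂ : D.p₁ ≡ D.p₂
    d₁≡d₂ = let (_ , p₁δ≡id , p₂δ≡id) = kernelPair-diagonal C K.isPullback
            in commonSection-collapses P p₁δ≡id p₂δ≡id D-pb.commute

    d₁-factorises : Σ (A.Hom D.obj (P.F₀ _)) λ v → P.F₁ e A.∘ v ≡ D.p₁
    d₁-factorises = P-weakCoequalizer-factorises e-weaklyCoequalises D.p₁
                      (trans D-pb.commute (cong (P.F₁ K.p₂ A.∘_) (sym d₁≡d₂)))

    v = proj₁ d₁-factorises
    Pev≡d₁ = proj₂ d₁-factorises

-- The pullback hypotheses of the paper only guarantee that the kernel pair and the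
-- dual span exist; here both are given.
theorem4p4 : ∀ {o₁ ℓ₁ o₂ ℓ₂} (𝕊 : Setting o₁ ℓ₁ o₂ ℓ₂) →
    let open Setting 𝕊 in
    HasPullbacks C →
    (HasPullbacks A ⊎ HasPushouts C) →
    RegEpiMonoFactorisationsOnC' →
    C'ClosedUnderRegEpiImages →
    ContraFaithful S →
    PreservesEpis L →
    (X : C.Obj) → InC' X → (γ : C.Hom X (T.F₀ X)) →
    (K : Pullback C (th γ) (th γ)) →
    IsρBisimulation γ γ (Pullback.p₁ K) (Pullback.p₂ K)
theorem4p4 𝕊 _ _ factorise closed faithful preservesEpis X X∈C' γ
  with factorise X∈C' (Setting.th 𝕊 γ)
... | _ , e , _ , e-regular , m-mono , me≡th =
  kernelPair-isρBisimulation 𝕊 faithful preservesEpis γ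
    (closed e X∈C' e-regular) e-regular m-mono me≡th
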